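{- Let $t$ be a positive integer and let $\mathcal A\in I(n,t)$ be fixed. Then $\mathcal C_{i,j}(\mathcal A)\in I(n,t)$ for any $i,j\in[n]$ with $i<j$.
   Context: $S_n$ is the symmetric group on $[n]=\{1,\dots,n\}$. Two permutations have a cycle in common if that cycle appears in both cycle decompositions (1-cycles count). A family $\mathcal A\subseteq S_n$ is $t$-cycle-intersecting if any two distinct members have at least $t$ cycles in common; $I(n,t)$ is the collection of all $t$-cycle-intersecting families in $S_n$. For $i\neq j$ and $\sigma\in S_n$, the $ij$-fixing ${}_{[ij]}\sigma$ is: $\sigma$ if $\sigma(i)\neq j$; if $\sigma(i)=j$, then ${}_{[ij]}\sigma(i)=i$, ${}_{[ij]}\sigma(\sigma^{ -1}(i))=j$, and ${}_{[ij]}\sigma(x)=\sigma(x)$ otherwise. For $\mathcal A\subseteq S_n$, $\triangleleft_{ij}(\mathcal A)=\{\triangleleft_{ij}(\sigma):\sigma\in\mathcal A\}$ where $\triangleleft_{ij}(\sigma)={}_{[ij]}\sigma$ if ${}_{[ij]}\sigma\notin\mathcal A$ and $\sigma$ otherwise. $\mathcal A$ is fixed if $\triangleleft_{ij}(\mathcal A)=\mathcal A$ for all $i\neq j$ in $[n]$. For $i<j$, the $(i,j)$-compression $\sigma_{i,j}$ is: $\sigma$ if $\sigma(i)=i$ or $\sigma(j)\ne j$; otherwise $\sigma_{i,j}(i)=i$, $\sigma_{i,j}(j)=\sigma(i)$, $\sigma_{i,j}(\sigma^{ -1}(i))=j$, and $\sigma_{i,j}(y)=\sigma(y)$ otherwise.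 $\mathcal C_{i,j}(\mathcal A)=\{\mathcal C_{i,j}(\sigma):\sigma\in\mathcal A\}$ where $\mathcal C_{i,j}(\sigma)=\sigma_{i,j}$ if $\sigma_{i,j}\notin\mathcal A$ and $\sigma$ otherwise. -}

module Defs where

open import Data.Nat using (ℕ; zero; suc)
open import Data.Fin using (Fin; _≟_)
open import Data.Vec using (Vec; lookup; tabulate)
open import Data.Product using (Σ; ∃; _×_; _,_)
open import Data.Sum using (_⊎_)
open import Relation.Nullary using (¬_; yes; no)
open import Relation.Binary.PropositionalEquality using (_≡_; _≢_)
open import Function.Definitions using (Injective; Surjective)
open import Function.Bundles using (_⇔_)

-- A map [n] → [n] in one-line notation: σ(x) = lookup σ x.
Map : ℕ → Set
Map n = Vec (Fin n) n

app : ∀ {n} → Map n → Fin n → Fin n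
app = lookup

IsPerm : ∀ {n} → Map n → Set
IsPerm σ = Injective _≡_ _≡_ (app σ) × Surjective _≡_ _≡_ (app σ)

iter : ∀ {n} → Map n → ℕ → Fin n → Fin n
iter σ zero    x = x
iter σ (suc k) x = app σ (iter σ k x)

-- The cycle of σ through x also appears in τ: τ agrees with σ on the σ-orbit of x.
CommonCycleAt : ∀ {n} → Map n → Map n → Fin n → Set
CommonCycleAt σ τ x = ∀ k → app τ (iter σ k x) ≡ app σ (iter σ k x)

SameCycle : ∀ {n} → Map n → Fin n → Fin n → Set
SameCycle σ x y = ∃ λ k → iter σ k x ≡ y

-- σ and τ have at least t cycles in common: there are t points on common
-- cycles, pairwise lying in distinct cycles.
AtLeastCommonCycles : ∀ {n} → ℕ → Map n → Map n → Set
AtLeastCommonCycles {n} t σ τ =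
  Σ (Fin t → Fin n) λ x →
    (∀ a → CommonCycleAt σ τ (x a)) ×
    (∀ a b → a ≢ b → ¬ SameCycle σ (x a) (x b))

Family : ℕ → Set₁
Family n = Map n → Set

InI : (n t : ℕ) → Family n → Set
InI n t 𝒜 =
  (∀ σ → 𝒜 σ → IsPerm σ) ×
  (∀ σ τ → 𝒜 σ → 𝒜 τ → σ ≢ τ → AtLeastCommonCycles t σ τ)

-- ij-fixing _[ij]σ.  (σ⁻¹(i) is the unique x with σ(x) = i.)
fixing : ∀ {n} → Fin n → Fin n → Map n → Map n
fixing i j σ with app σ i ≟ j
... | no  _ = σ
... | yes _ = tabulate λ x → h x
  where
  h : _ → _
  h x with x ≟ i
  ... | yes _ = i
  ... | no  _ with app σ x ≟ i
  ...   | yes _ = j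
  ...   | no  _ = app σ x

compress : ∀ {n} → Fin n → Fin n → Map n → Map n
compress i j σ with app σ i ≟ i | app σ j ≟ j
... | yes _ | _     = σ
... | no  _ | no  _ = σ
... | no  _ | yes _ = tabulate λ x → h x
  where
  h : _ → _
  h x with x ≟ i
  ... | yes _ = i
  ... | no  _ with x ≟ j
  ...   | yes _ = app σ i
  ...   | no  _ with app σ x ≟ i
  ...     | yes _ = j
  ...     | no  _ = app σ x

shift : ∀ {n} → (Map n → Map n) → Family n → Family n
shift f 𝒜 τ = ∃ λ σ → 𝒜 σ × ((¬ 𝒜 (f σ) × τ ≡ f σ) ⊎ (𝒜 (f σ) × τ ≡ σ))

◁ : ∀ {n} → Fin n → Fin n → Family n → Family n
◁ i j = shift (fixing i j)

𝒞 : ∀ {n} → Fin n → Fin n → Family n → Family n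
𝒞 i j = shift (compress i j)

Fixed : ∀ {n} → Family n → Set
Fixed {n} 𝒜 = ∀ (i j : Fin n) → i ≢ j → ∀ τ → (◁ i j 𝒜 τ ⇔ 𝒜 τ)

-- Write π for the transposition (i j).  If σ moves i and fixes j
-- ("σ is active") then its compression is the conjugate π σ π; otherwise the
-- compression is σ itself.  Conjugation by an involution maps permutations to
-- permutations and common cycles to common cycles, which settles every pair of
-- members of 𝒞(𝒜) except a compressed κ = π σ₁ π (with κ ∉ 𝒜) against a kept
-- σ₂ (with its compression in 𝒜).  There we split on σ₂:
--   * σ₂ active, or σ₂ fixing both i and j: σ₂ is the conjugate of some member
--     of 𝒜 (of its compression, resp. of itself), so conjugation applies again;
--   * σ₂ moving j: a common cycle of σ₂ with σ₁ (if σ₂ i ≠ σ₁ i), resp. with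
--     the ij-fixing ρ of σ₁ (if σ₂ i = σ₁ i, ρ ∈ 𝒜 because 𝒜 is fixed), never
--     meets the points where κ differs from σ₁, resp. ρ, so it is a common
--     cycle of κ and σ₂ as well.
module Submission where

open import Defs
open import Data.Nat using (ℕ; _≤_; zero; suc)
open import Data.Fin using (Fin; _<_; _≟_)
open import Algebra.Definitions using (Involutive)
open import Data.Fin.Permutation.Components using (transpose)
open import Data.Fin.Properties using (<⇒≢)
open import Data.Product using (Σ; _×_; _,_; proj₁)
open import Data.Sum using (_⊎_; inj₁; inj₂)
open import Data.Vec using (lookup; tabulate)
open import Data.Vec.Properties using (lookup∘tabulate)
open import Function.Bundles using (Equivalence)
open import Function.Definitions using (Injective)
open import Relation.Nullary using (¬_; Dec; yes; no)
open import Relation.Nullary.Negation using (contradiction)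
open import Relation.Binary.PropositionalEquality

module _ {n : ℕ} (i j : Fin n) where

  transpose-matchˡ : transpose i j i ≡ j
  transpose-matchˡ with i ≟ i
  ... | yes _   = refl
  ... | no i≢i = contradiction refl i≢i

  transpose-matchʳ : transpose i j j ≡ i
  transpose-matchʳ with j ≟ i
  ... | yes j≡i = j≡i
  ... | no _ with j ≟ j
  ...   | yes _   = refl
  ...   | no j≢j = contradiction refl j≢j

  transpose-other : ∀ {k} → k ≢ i → k ≢ j → transpose i j k ≡ k
  transpose-other {k} k≢i k≢j with k ≟ i
  ... | yes k≡i = contradiction k≡i k≢i
  ... | no _ with k ≟ j
  ...   | yes k≡j = contradiction k≡j k≢j
  ...   | no _    = refl

  transpose-involutive : Involutive _≡_ (transpose i j)
  transpose-involutive k with k ≟ i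
  ... | yes refl = transpose-matchʳ
  ... | no k≢i with k ≟ j
  ...   | yes refl = transpose-matchˡ
  ...   | no k≢j   = transpose-other k≢i k≢j

orbit-common : ∀ {n} {σ τ : Map n} {x} → CommonCycleAt σ τ x →
  ∀ k → iter τ k x ≡ iter σ k x
orbit-common c zero = refl
orbit-common {τ = τ} c (suc k) = trans (cong (app τ) (orbit-common c k)) (c k)

-- Distinct cycles of σ that are common to σ and ρ and to σ and ρ' are
-- distinct common cycles of ρ and ρ' (the ρ-cycle through them is the σ-cycle).
common-via : ∀ {n t} (σ ρ ρ' : Map n) (x : Fin t → Fin n) →
  (∀ a → CommonCycleAt σ ρ (x a)) → (∀ a → CommonCycleAt σ ρ' (x a)) →
  (∀ a b → a ≢ b → ¬ SameCycle σ (x a) (x b)) → AtLeastCommonCycles t ρ ρ'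
common-via σ ρ ρ' x onρ onρ' distinct = x , common , distinct′
  where
  common : ∀ a → CommonCycleAt ρ ρ' (x a)
  common a k = begin
    app ρ' (iter ρ k (x a)) ≡⟨ cong (app ρ') (orbit-common (onρ a) k) ⟩
    app ρ' (iter σ k (x a)) ≡⟨ onρ' a k ⟩
    app σ  (iter σ k (x a)) ≡⟨ sym (onρ a k) ⟩
    app ρ  (iter σ k (x a)) ≡⟨ cong (app ρ) (sym (orbit-common (onρ a) k)) ⟩
    app ρ  (iter ρ k (x a)) ∎
    where open ≡-Reasoning
  distinct′ : ∀ a b → a ≢ b → ¬ SameCycle ρ (x a) (x b)
  distinct′ a b a≢b (k , e) = distinct a b a≢b (k , trans (sym (orbit-common (onρ a) k)) e)

common-sym : ∀ {n t} {σ τ : Map n} → AtLeastCommonCycles t σ τ → AtLeastCommonCycles t τ σ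
common-sym {σ = σ} {τ} (x , common , distinct) = common-via σ τ σ x common (λ a k → refl) distinct

common-transfer : ∀ {n t} {ρ κ τ : Map n} →
  (∀ w → app τ w ≡ app ρ w → app τ (app ρ w) ≡ app ρ (app ρ w) → app κ w ≡ app ρ w) →
  AtLeastCommonCycles t ρ τ → AtLeastCommonCycles t κ τ
common-transfer {ρ = ρ} {κ} {τ} agree (x , common , distinct) =
  common-via ρ κ τ x (λ a k → agree _ (common a k) (common a (suc k))) common distinct

-- σ' is the conjugate f σ f of σ by the involution f.  (A record, so that σ
-- and σ' can be read off its type.)
record Conjugate {n : ℕ} (f : Fin n → Fin n) (σ σ' : Map n) : Set where
  constructor conjugation
  field pointwise : ∀ y → app σ' y ≡ f (app σ (f y))
open Conjugate using (pointwise)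

-- Conjugation by an involution f relabels points by f, so it preserves being a
-- permutation and sends common cycles at x to common cycles at f x.
module Conjugation {n : ℕ} {f : Fin n → Fin n} (f-inv : Involutive _≡_ f) where

  f-injective : Injective _≡_ _≡_ f
  f-injective {x} {y} e = trans (sym (f-inv x)) (trans (cong f e) (f-inv y))

  conjugate-at : ∀ {σ σ'} → Conjugate f σ σ' → ∀ w → app σ' (f w) ≡ f (app σ w)
  conjugate-at {σ} h w = trans (pointwise h (f w)) (cong (λ z → f (app σ z)) (f-inv w))

  conjugate-sym : ∀ {σ σ'} → Conjugate f σ σ' → Conjugate f σ' σ
  conjugate-sym {σ} {σ'} h = conjugation λ y → begin
    app σ y          ≡⟨ sym (f-inv (app σ y)) ⟩
    f (f (app σ y))  ≡⟨ cong f (sym (conjugate-at h y)) ⟩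
    f (app σ' (f y)) ∎
    where open ≡-Reasoning

  iter-conjugate : ∀ {σ σ'} → Conjugate f σ σ' → ∀ k y → iter σ' k (f y) ≡ f (iter σ k y)
  iter-conjugate h zero y = refl
  iter-conjugate {σ' = σ'} h (suc k) y =
    trans (cong (app σ') (iter-conjugate h k y)) (conjugate-at h _)

  conjugate-perm : ∀ {σ σ'} → Conjugate f σ σ' → IsPerm σ → IsPerm σ'
  conjugate-perm {σ} {σ'} h (σ-inj , σ-surj) = injective , surjective
    where
    injective : Injective _≡_ _≡_ (app σ')
    injective {x} {y} e = f-injective (σ-inj (f-injective (trans (sym (pointwise h x)) (trans e (pointwise h y)))))
    surjective : ∀ y → Σ (Fin n) λ x → ∀ {z} → z ≡ x → app σ' z ≡ y
    surjective y with σ-surj (f y)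
    ... | x , hit = f x , λ { refl → trans (conjugate-at h x) (trans (cong f (hit refl)) (f-inv y)) }

  conjugate-common : ∀ {t σ σ' τ τ'} → Conjugate f σ σ' → Conjugate f τ τ' →
    AtLeastCommonCycles t σ τ → AtLeastCommonCycles t σ' τ'
  conjugate-common {σ = σ} {σ'} {τ} {τ'} hσ hτ (x , common , distinct) =
    (λ a → f (x a)) , common′ , distinct′
    where
    common′ : ∀ a → CommonCycleAt σ' τ' (f (x a))
    common′ a k = begin
      app τ' (iter σ' k (f (x a))) ≡⟨ cong (app τ') (iter-conjugate hσ k (x a)) ⟩
      app τ' (f (iter σ k (x a)))  ≡⟨ conjugate-at hτ _ ⟩
      f (app τ (iter σ k (x a)))   ≡⟨ cong f (common a k) ⟩
      f (app σ (iter σ k (x a)))   ≡⟨ sym (conjugate-at hσ _) ⟩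
      app σ' (f (iter σ k (x a)))  ≡⟨ cong (app σ') (sym (iter-conjugate hσ k (x a))) ⟩
      app σ' (iter σ' k (f (x a))) ∎
      where open ≡-Reasoning
    distinct′ : ∀ a b → a ≢ b → ¬ SameCycle σ' (f (x a)) (f (x b))
    distinct′ a b a≢b (k , e) =
      distinct a b a≢b (k , f-injective (trans (sym (iter-conjugate hσ k (x a))) e))

conjugate-self : ∀ {n} {i j : Fin n} {σ : Map n} → Injective _≡_ _≡_ (app σ) →
  app σ i ≡ i → app σ j ≡ j → Conjugate (transpose i j) σ σ
conjugate-self {i = i} {j} {σ} σ-inj σi≡i σj≡j = conjugation λ y → sym (at y (y ≟ i) (y ≟ j))
  where
  open ≡-Reasoning
  at : ∀ y → Dec (y ≡ i) → Dec (y ≡ j) → transpose i j (app σ (transpose i j y)) ≡ app σ y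
  at y (yes refl) _ = begin
    transpose y j (app σ (transpose y j y)) ≡⟨ cong (λ z → transpose y j (app σ z)) (transpose-matchˡ y j) ⟩
    transpose y j (app σ j)                 ≡⟨ cong (transpose y j) σj≡j ⟩
    transpose y j j                         ≡⟨ transpose-matchʳ y j ⟩
    y                                       ≡⟨ sym σi≡i ⟩
    app σ y                                 ∎
  at y (no _) (yes refl) = begin
    transpose i y (app σ (transpose i y y)) ≡⟨ cong (λ z → transpose i y (app σ z)) (transpose-matchʳ i y) ⟩
    transpose i y (app σ i)                 ≡⟨ cong (transpose i y) σi≡i ⟩
    transpose i y i                         ≡⟨ transpose-matchˡ i y ⟩
    y                                       ≡⟨ sym σj≡j ⟩
    app σ y                                 ∎
  at y (no y≢i) (no y≢j) = begin
    transpose i j (app σ (transpose i j y)) ≡⟨ cong (λ z → transpose i j (app σ z)) (transpose-other i j y≢i y≢j) ⟩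
    transpose i j (app σ y)                 ≡⟨ transpose-other i j (λ e → y≢i (σ-inj (trans e (sym σi≡i))))
                                                                    (λ e → y≢j (σ-inj (trans e (sym σj≡j)))) ⟩
    app σ y                                 ∎

Active : ∀ {n} → Fin n → Fin n → Map n → Set
Active i j σ = app σ i ≢ i × app σ j ≡ j

active-or-unmoved : ∀ {n} (i j : Fin n) (σ : Map n) → Active i j σ ⊎ compress i j σ ≡ σ
active-or-unmoved i j σ with app σ i ≟ i | app σ j ≟ j
... | yes _   | _       = inj₂ refl
... | no _    | no _    = inj₂ refl
... | no σi≢i | yes σj≡j = inj₁ (σi≢i , σj≡j)

-- Entries of a tabulated vector, read through an equation as produced by
-- `with … in`; needed to evaluate compress and fixing, which tabulate.
lookup-tabulate : ∀ {n} {A : Set} {f : Fin n → A} {v} → tabulate f ≡ v → ∀ y → lookup v y ≡ f y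
lookup-tabulate {f = f} refl y = lookup∘tabulate f y

-- The compression of an active σ is the map of the paper's definition: any g
-- with the four defining values agrees with it.
compress-spec : ∀ {n} {i j : Fin n} {σ : Map n} → Active i j σ → (g : Fin n → Fin n) →
  g i ≡ i → g j ≡ app σ i →
  (∀ y → y ≢ i → y ≢ j → app σ y ≡ i → g y ≡ j) →
  (∀ y → y ≢ i → y ≢ j → app σ y ≢ i → g y ≡ app σ y) →
  ∀ y → app (compress i j σ) y ≡ g y
compress-spec {i = i} {j} {σ} (σi≢i , σj≡j) g gi gj gpre gelse y
  with app σ i ≟ i | app σ j ≟ j | compress i j σ in eq
... | yes σi≡i | _       | _ = contradiction σi≡i σi≢i
... | no _     | no σj≢j | _ = contradiction σj≡j σj≢j
... | no _     | yes _   | _ rewrite lookup-tabulate eq y with y ≟ i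
...   | yes refl = sym gi
...   | no y≢i with y ≟ j
...     | yes refl = sym gj
...     | no y≢j with app σ y ≟ i
...       | yes σy≡i = sym (gpre y y≢i y≢j σy≡i)
...       | no σy≢i  = sym (gelse y y≢i y≢j σy≢i)

module TransposedConjugate {n : ℕ} {i j : Fin n} {σ : Map n} (i≢j : i ≢ j)
  (σ-inj : Injective _≡_ _≡_ (app σ)) (σi≢i : app σ i ≢ i) (σj≡j : app σ j ≡ j) where

  open ≡-Reasoning

  conj : Fin n → Fin n
  conj y = transpose i j (app σ (transpose i j y))

  σy≢j : ∀ {y} → y ≢ j → app σ y ≢ j
  σy≢j y≢j σy≡j = y≢j (σ-inj (trans σy≡j (sym σj≡j)))

  at-i : conj i ≡ i
  at-i = begin
    transpose i j (app σ (transpose i j i)) ≡⟨ cong (λ z → transpose i j (app σ z)) (transpose-matchˡ i j) ⟩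
    transpose i j (app σ j)                 ≡⟨ cong (transpose i j) σj≡j ⟩
    transpose i j j                         ≡⟨ transpose-matchʳ i j ⟩
    i                                       ∎

  at-j : conj j ≡ app σ i
  at-j = begin
    transpose i j (app σ (transpose i j j)) ≡⟨ cong (λ z → transpose i j (app σ z)) (transpose-matchʳ i j) ⟩
    transpose i j (app σ i)                 ≡⟨ transpose-other i j σi≢i (σy≢j i≢j) ⟩
    app σ i                                 ∎

  at-preimage : ∀ y → y ≢ i → y ≢ j → app σ y ≡ i → conj y ≡ j
  at-preimage y y≢i y≢j σy≡i = begin
    transpose i j (app σ (transpose i j y)) ≡⟨ cong (λ z → transpose i j (app σ z)) (transpose-other i j y≢i y≢j) ⟩
    transpose i j (app σ y)                 ≡⟨ cong (transpose i j) σy≡i ⟩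
    transpose i j i                         ≡⟨ transpose-matchˡ i j ⟩
    j                                       ∎

  elsewhere : ∀ y → y ≢ i → y ≢ j → app σ y ≢ i → conj y ≡ app σ y
  elsewhere y y≢i y≢j σy≢i = begin
    transpose i j (app σ (transpose i j y)) ≡⟨ cong (λ z → transpose i j (app σ z)) (transpose-other i j y≢i y≢j) ⟩
    transpose i j (app σ y)                 ≡⟨ transpose-other i j σy≢i (σy≢j y≢j) ⟩
    app σ y                                 ∎

compress-conjugate : ∀ {n} {i j : Fin n} {σ : Map n} → i ≢ j → Injective _≡_ _≡_ (app σ) →
  Active i j σ → Conjugate (transpose i j) σ (compress i j σ)
compress-conjugate {σ = σ} i≢j σ-inj (σi≢i , σj≡j) = conjugation
  (compress-spec {σ = σ} (σi≢i , σj≡j) conj at-i at-j at-preimage elsewhere)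
  where open TransposedConjugate {σ = σ} i≢j σ-inj σi≢i σj≡j

module _ {n : ℕ} {i b : Fin n} {σ : Map n} (σi≡b : app σ i ≡ b) where

  fixing-at-i : app (fixing i b σ) i ≡ i
  fixing-at-i with app σ i ≟ b | fixing i b σ in eq
  ... | no σi≢b | _ = contradiction σi≡b σi≢b
  ... | yes _   | _ rewrite lookup-tabulate eq i with i ≟ i
  ...   | yes _   = refl
  ...   | no i≢i = contradiction refl i≢i

  fixing-at-preimage : ∀ {w} → w ≢ i → app σ w ≡ i → app (fixing i b σ) w ≡ b
  fixing-at-preimage {w} w≢i σw≡i with app σ i ≟ b | fixing i b σ in eq
  ... | no σi≢b | _ = contradiction σi≡b σi≢b
  ... | yes _   | _ rewrite lookup-tabulate eq w with w ≟ i
  ...   | yes w≡i = contradiction w≡i w≢i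
  ...   | no _ with app σ w ≟ i
  ...     | yes _    = refl
  ...     | no σw≢i = contradiction σw≡i σw≢i

  fixing-elsewhere : ∀ {w} → w ≢ i → app σ w ≢ i → app (fixing i b σ) w ≡ app σ w
  fixing-elsewhere {w} w≢i σw≢i with app σ i ≟ b | fixing i b σ in eq
  ... | no σi≢b | _ = contradiction σi≡b σi≢b
  ... | yes _   | _ rewrite lookup-tabulate eq w with w ≟ i
  ...   | yes w≡i = contradiction w≡i w≢i
  ...   | no _ with app σ w ≟ i
  ...     | yes σw≡i = contradiction σw≡i σw≢i
  ...     | no _     = refl

-- A family contained in its own shift along f is closed under f: the preimage
-- of σ in the shift cannot have been moved (σ is already in 𝒜).
shift-closed : ∀ {n} {f : Map n → Map n} {𝒜 : Family n} →
  (∀ σ → 𝒜 σ → shift f 𝒜 σ) → ∀ σ → 𝒜 σ → 𝒜 (f σ)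
shift-closed 𝒜⊆shift σ 𝒜σ with 𝒜⊆shift σ 𝒜σ
... | _ , _ , inj₁ (¬𝒜fσ , refl) = contradiction 𝒜σ ¬𝒜fσ
... | _ , _ , inj₂ (𝒜fσ , refl)  = 𝒜fσ

fixed-closed : ∀ {n} {𝒜 : Family n} → Fixed 𝒜 → ∀ {i j} → i ≢ j →
  ∀ σ → 𝒜 σ → 𝒜 (fixing i j σ)
fixed-closed fixed {i} {j} i≢j = shift-closed (λ τ → Equivalence.from (fixed i j i≢j τ))

module Compression {n t : ℕ} {𝒜 : Family n} (i j : Fin n) (i≢j : i ≢ j)
  (perm : ∀ σ → 𝒜 σ → IsPerm σ)
  (inter : ∀ σ τ → 𝒜 σ → 𝒜 τ → σ ≢ τ → AtLeastCommonCycles t σ τ)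
  (fixed : Fixed 𝒜) where

  open Conjugation {f = transpose i j} (transpose-involutive i j)

  c : Map n → Map n
  c σ = compress i j σ

  c-conjugate : ∀ {σ} → 𝒜 σ → Active i j σ → Conjugate (transpose i j) σ (c σ)
  c-conjugate {σ} 𝒜σ = compress-conjugate i≢j (proj₁ (perm σ 𝒜σ))

  moved-active : ∀ {σ} → 𝒜 σ → ¬ 𝒜 (c σ) → Active i j σ
  moved-active {σ} 𝒜σ ¬𝒜cσ with active-or-unmoved i j σ
  ... | inj₁ active = active
  ... | inj₂ cσ≡σ   = contradiction (subst 𝒜 (sym cσ≡σ) 𝒜σ) ¬𝒜cσ

  compress-perm : ∀ {σ} → 𝒜 σ → IsPerm (c σ)
  compress-perm {σ} 𝒜σ with active-or-unmoved i j σ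
  ... | inj₁ active = conjugate-perm (c-conjugate 𝒜σ active) (perm σ 𝒜σ)
  ... | inj₂ cσ≡σ   = subst IsPerm (sym cσ≡σ) (perm σ 𝒜σ)

  c-fixes-i : ∀ {σ} → 𝒜 σ → Active i j σ → app (c σ) i ≡ i
  c-fixes-i {σ} 𝒜σ (σi≢i , σj≡j) = trans (pointwise (c-conjugate 𝒜σ (σi≢i , σj≡j)) i) at-i
    where open TransposedConjugate {σ = σ} i≢j (proj₁ (perm σ 𝒜σ)) σi≢i σj≡j using (at-i)

  c-elsewhere : ∀ {σ w} → 𝒜 σ → Active i j σ → w ≢ i → w ≢ j → app σ w ≢ i → app (c σ) w ≡ app σ w
  c-elsewhere {σ} {w} 𝒜σ (σi≢i , σj≡j) w≢i w≢j σw≢i =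
    trans (pointwise (c-conjugate 𝒜σ (σi≢i , σj≡j)) w) (elsewhere w w≢i w≢j σw≢i)
    where open TransposedConjugate {σ = σ} i≢j (proj₁ (perm σ 𝒜σ)) σi≢i σj≡j using (elsewhere)

  -- Both members compressed: conjugate the common cycles of their preimages.
  both-moved : ∀ {σ₁ σ₂} → 𝒜 σ₁ → 𝒜 σ₂ → ¬ 𝒜 (c σ₁) → ¬ 𝒜 (c σ₂) → c σ₁ ≢ c σ₂ →
    AtLeastCommonCycles t (c σ₁) (c σ₂)
  both-moved {σ₁} {σ₂} 𝒜σ₁ 𝒜σ₂ ¬𝒜cσ₁ ¬𝒜cσ₂ cσ₁≢cσ₂ =
    conjugate-common (c-conjugate 𝒜σ₁ (moved-active 𝒜σ₁ ¬𝒜cσ₁)) (c-conjugate 𝒜σ₂ (moved-active 𝒜σ₂ ¬𝒜cσ₂))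
      (inter σ₁ σ₂ 𝒜σ₁ 𝒜σ₂ (λ σ₁≡σ₂ → cσ₁≢cσ₂ (cong c σ₁≡σ₂)))

  -- In the remaining cases σ₁ ∈ 𝒜 is active and compared, after compression,
  -- with σ₂ ∈ 𝒜.  σ₂ active: σ₂ is the conjugate of c σ₂ ∈ 𝒜, which fixes i.
  versus-active : ∀ {σ₁ σ₂} → 𝒜 σ₁ → Active i j σ₁ → 𝒜 σ₂ → Active i j σ₂ → 𝒜 (c σ₂) →
    AtLeastCommonCycles t (c σ₁) σ₂
  versus-active {σ₁} {σ₂} 𝒜σ₁ active₁ 𝒜σ₂ active₂ 𝒜cσ₂ =
    conjugate-common {τ = c σ₂} {τ' = σ₂} (c-conjugate 𝒜σ₁ active₁) (conjugate-sym (c-conjugate 𝒜σ₂ active₂))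
      (inter σ₁ (c σ₂) 𝒜σ₁ 𝒜cσ₂ λ σ₁≡cσ₂ →
        proj₁ active₁ (trans (cong (λ v → app v i) σ₁≡cσ₂) (c-fixes-i 𝒜σ₂ active₂)))

  -- σ₂ fixing i and j is its own conjugate.
  versus-fixing-both : ∀ {σ₁ σ₂} → 𝒜 σ₁ → Active i j σ₁ → 𝒜 σ₂ → app σ₂ i ≡ i → app σ₂ j ≡ j →
    AtLeastCommonCycles t (c σ₁) σ₂
  versus-fixing-both {σ₁} {σ₂} 𝒜σ₁ active₁ 𝒜σ₂ σ₂i≡i σ₂j≡j =
    conjugate-common {τ = σ₂} {τ' = σ₂} (c-conjugate 𝒜σ₁ active₁) (conjugate-self {σ = σ₂} (proj₁ (perm σ₂ 𝒜σ₂)) σ₂i≡i σ₂j≡j)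
      (inter σ₁ σ₂ 𝒜σ₁ 𝒜σ₂ λ σ₁≡σ₂ → proj₁ active₁ (trans (cong (λ v → app v i) σ₁≡σ₂) σ₂i≡i))

  -- σ₂ moves j and σ₂ i ≠ σ₁ i: common cycles of σ₁ and σ₂ avoid i, j and
  -- σ₁⁻¹(i), where alone c σ₁ differs from σ₁.
  versus-differing : ∀ {σ₁ σ₂} → 𝒜 σ₁ → Active i j σ₁ → 𝒜 σ₂ →
    app σ₂ j ≢ j → app σ₂ i ≢ app σ₁ i → AtLeastCommonCycles t (c σ₁) σ₂
  versus-differing {σ₁} {σ₂} 𝒜σ₁ (σ₁i≢i , σ₁j≡j) 𝒜σ₂ σ₂j≢j σ₂i≢σ₁i =
    common-transfer {τ = σ₂} agree (inter σ₁ σ₂ 𝒜σ₁ 𝒜σ₂ λ σ₁≡σ₂ →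
      σ₂j≢j (trans (cong (λ v → app v j) (sym σ₁≡σ₂)) σ₁j≡j))
    where
    agree : ∀ w → app σ₂ w ≡ app σ₁ w → app σ₂ (app σ₁ w) ≡ app σ₁ (app σ₁ w) →
      app (c σ₁) w ≡ app σ₁ w
    agree w e e′ with w ≟ i | w ≟ j | app σ₁ w ≟ i
    ... | yes refl | _        | _         = contradiction e σ₂i≢σ₁i
    ... | no _     | yes refl | _         = contradiction (trans e σ₁j≡j) σ₂j≢j
    ... | no _     | no _     | yes σ₁w≡i =
      contradiction (subst (λ z → app σ₂ z ≡ app σ₁ z) σ₁w≡i e′) σ₂i≢σ₁i
    ... | no w≢i   | no w≢j   | no σ₁w≢i  = c-elsewhere 𝒜σ₁ (σ₁i≢i , σ₁j≡j) w≢i w≢j σ₁w≢i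

  -- σ₂ moves j and σ₂ i = σ₁ i: compare instead with the ij-fixing ρ ∈ 𝒜 of
  -- σ₁ (i ↦ i, σ₁⁻¹(i) ↦ σ₁ i); common cycles of ρ and σ₂ avoid j and σ₁⁻¹(i),
  -- where alone c σ₁ differs from ρ.
  versus-sharing : ∀ {σ₁ σ₂} → 𝒜 σ₁ → Active i j σ₁ → 𝒜 σ₂ →
    app σ₂ j ≢ j → app σ₂ i ≡ app σ₁ i → AtLeastCommonCycles t (c σ₁) σ₂
  versus-sharing {σ₁} {σ₂} 𝒜σ₁ (σ₁i≢i , σ₁j≡j) 𝒜σ₂ σ₂j≢j σ₂i≡σ₁i =
    common-transfer {τ = σ₂} agree (inter ρ σ₂ 𝒜ρ 𝒜σ₂ λ ρ≡σ₂ →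
      σ₂j≢j (trans (cong (λ v → app v j) (sym ρ≡σ₂)) ρj≡j))
    where
    ρ : Map n
    ρ = fixing i (app σ₁ i) σ₁
    𝒜ρ : 𝒜 ρ
    𝒜ρ = fixed-closed fixed (λ i≡σ₁i → σ₁i≢i (sym i≡σ₁i)) σ₁ 𝒜σ₁
    ρj≡j : app ρ j ≡ j
    ρj≡j = trans (fixing-elsewhere {σ = σ₁} refl (λ j≡i → i≢j (sym j≡i)) (λ σ₁j≡i → i≢j (trans (sym σ₁j≡i) σ₁j≡j)))
                 σ₁j≡j
    agree : ∀ w → app σ₂ w ≡ app ρ w → app σ₂ (app ρ w) ≡ app ρ (app ρ w) → app (c σ₁) w ≡ app ρ w
    agree w e _ with w ≟ i | w ≟ j | app σ₁ w ≟ i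
    ... | yes refl | _        | _         = trans (c-fixes-i 𝒜σ₁ (σ₁i≢i , σ₁j≡j)) (sym (fixing-at-i {σ = σ₁} refl))
    ... | no _     | yes refl | _         = contradiction (trans e ρj≡j) σ₂j≢j
    ... | no w≢i   | no _     | yes σ₁w≡i =
      contradiction (proj₁ (perm σ₂ 𝒜σ₂) (trans e (trans (fixing-at-preimage {σ = σ₁} refl w≢i σ₁w≡i) (sym σ₂i≡σ₁i)))) w≢i
    ... | no w≢i   | no w≢j   | no σ₁w≢i  =
      trans (c-elsewhere 𝒜σ₁ (σ₁i≢i , σ₁j≡j) w≢i w≢j σ₁w≢i) (sym (fixing-elsewhere {σ = σ₁} refl w≢i σ₁w≢i))

  moved-vs-kept : ∀ {σ₁ σ₂} → 𝒜 σ₁ → ¬ 𝒜 (c σ₁) → 𝒜 σ₂ → 𝒜 (c σ₂) → AtLeastCommonCycles t (c σ₁) σ₂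
  moved-vs-kept {σ₁} {σ₂} 𝒜σ₁ ¬𝒜cσ₁ 𝒜σ₂ 𝒜cσ₂ =
    by-cases (app σ₂ j ≟ j) (app σ₂ i ≟ i) (app σ₂ i ≟ app σ₁ i)
    where
    active₁ : Active i j σ₁
    active₁ = moved-active 𝒜σ₁ ¬𝒜cσ₁
    by-cases : Dec (app σ₂ j ≡ j) → Dec (app σ₂ i ≡ i) → Dec (app σ₂ i ≡ app σ₁ i) →
      AtLeastCommonCycles t (c σ₁) σ₂
    by-cases (yes σ₂j≡j) (no σ₂i≢i)  _ = versus-active 𝒜σ₁ active₁ 𝒜σ₂ (σ₂i≢i , σ₂j≡j) 𝒜cσ₂
    by-cases (yes σ₂j≡j) (yes σ₂i≡i) _ = versus-fixing-both 𝒜σ₁ active₁ 𝒜σ₂ σ₂i≡i σ₂j≡j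
    by-cases (no σ₂j≢j) _ (no σ₂i≢σ₁i)  = versus-differing 𝒜σ₁ active₁ 𝒜σ₂ σ₂j≢j σ₂i≢σ₁i
    by-cases (no σ₂j≢j) _ (yes σ₂i≡σ₁i) = versus-sharing 𝒜σ₁ active₁ 𝒜σ₂ σ₂j≢j σ₂i≡σ₁i

  compressed-in-I : InI n t (𝒞 i j 𝒜)
  compressed-in-I = members-perm , members-intersect
    where
    members-perm : ∀ τ → 𝒞 i j 𝒜 τ → IsPerm τ
    members-perm _ (σ , 𝒜σ , inj₁ (_ , refl)) = compress-perm 𝒜σ
    members-perm _ (σ , 𝒜σ , inj₂ (_ , refl)) = perm σ 𝒜σ
    members-intersect : ∀ τ₁ τ₂ → 𝒞 i j 𝒜 τ₁ → 𝒞 i j 𝒜 τ₂ → τ₁ ≢ τ₂ → AtLeastCommonCycles t τ₁ τ₂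
    members-intersect _ _ (σ₁ , 𝒜σ₁ , inj₁ (¬𝒜cσ₁ , refl)) (σ₂ , 𝒜σ₂ , inj₁ (¬𝒜cσ₂ , refl)) τ₁≢τ₂ =
      both-moved 𝒜σ₁ 𝒜σ₂ ¬𝒜cσ₁ ¬𝒜cσ₂ τ₁≢τ₂
    members-intersect _ _ (σ₁ , 𝒜σ₁ , inj₁ (¬𝒜cσ₁ , refl)) (σ₂ , 𝒜σ₂ , inj₂ (𝒜cσ₂ , refl)) _ =
      moved-vs-kept 𝒜σ₁ ¬𝒜cσ₁ 𝒜σ₂ 𝒜cσ₂
    members-intersect _ _ (σ₁ , 𝒜σ₁ , inj₂ (𝒜cσ₁ , refl)) (σ₂ , 𝒜σ₂ , inj₁ (¬𝒜cσ₂ , refl)) _ =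
      common-sym (moved-vs-kept 𝒜σ₂ ¬𝒜cσ₂ 𝒜σ₁ 𝒜cσ₁)
    members-intersect _ _ (σ₁ , 𝒜σ₁ , inj₂ (_ , refl)) (σ₂ , 𝒜σ₂ , inj₂ (_ , refl)) τ₁≢τ₂ =
      inter σ₁ σ₂ 𝒜σ₁ 𝒜σ₂ τ₁≢τ₂

proposition2p5 : (n t : ℕ) → 1 ≤ t → (𝒜 : Family n) → InI n t 𝒜 → Fixed 𝒜 →
    (i j : Fin n) → i < j → InI n t (𝒞 i j 𝒜)
proposition2p5 n t _ 𝒜 (perm , inter) fixed i j i<j =
  Compression.compressed-in-I i j (<⇒≢ i<j) perm inter fixed
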